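{- Let $\pi$ be an increasing oscillation and let $r\ge1$. If $\oplus^r(21)\le\pi$, then $3r-1\le 2n$ when $\pi\in\{W_{2n},M_{2n}\}$, and $3r\le 2n$ when $\pi\in\{W_{2n-1},M_{2n-1}\}$.
   Context: Permutations are nonempty finite permutations in one-line notation; $\sigma\le\pi$ means $\sigma$ is contained in $\pi$ as a pattern (there are positions $i_1<\dots<i_m$ with $\pi_{i_r}<\pi_{i_s}$ iff $\sigma_r<\sigma_s$). For $\alpha$ of length $m$ and $\beta$ of length $n$, $\alpha\oplus\beta=\alpha_1\cdots\alpha_m(\beta_1+m)\cdots(\beta_n+m)$, and $\oplus^r(21)$ is the sum of $r$ copies of $21$. The interleave $\alpha\odot\beta$ is obtained from $\alpha\oplus\beta$ by exchanging the value of the largest entry coming from $\alpha$ with the value of the smallest entry coming from $\beta$; e.g. $321\odot213=421536$. $\odot^n(21)=21\odot\cdots\odot21$ ($n$ copies), e.g. $\odot^3(21)=315264$. An increasing oscillation is a simple permutation contained in the sequence $4,1,6,3,8,5,\dots,2k+2,2k-1,\dots$; those of length at least 4 are exactly $W_N,M_N$ with $W_{2n}=\odot^n(21)$, $W_{2n-1}=(\odot^{n-1}(21))\odot1$, $M_{2n}=1\odot(\odot^{n-1}(21))\odot1$, $M_{2n-1}=1\odot(\odot^{n-1}(21))$; e.g. $W_4=3142$, $W_5=31524$, $M_4=2413$. -}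

module Defs where

open import Data.Nat using (ℕ; zero; suc; _+_; _<_; _≟_)
open import Data.Bool using (if_then_else_)
open import Data.List using (List; []; _∷_; _++_; map; length; lookup)
open import Data.List.Relation.Binary.Sublist.Propositional using (_⊆_)
open import Data.Fin using (Fin; cast)
open import Data.Product using (Σ; ∃; _×_)
open import Function.Bundles using (_⇔_)
open import Relation.Binary.PropositionalEquality using (_≡_)
open import Relation.Nullary.Decidable using (⌊_⌋)

-- Permutations in one-line notation, as lists of values 1..n.
Perm : Set
Perm = List ℕ

OrderIso : List ℕ → List ℕ → Set
OrderIso σ τ =
  Σ (length σ ≡ length τ) λ eq →
    ∀ (i j : Fin (length σ)) →
      (lookup σ i < lookup σ j) ⇔ (lookup τ (cast eq i) < lookup τ (cast eq j))

_≼_ : Perm → Perm → Set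
σ ≼ π = ∃ λ τ → (τ ⊆ π) × OrderIso σ τ

_⊕_ : Perm → Perm → Perm
α ⊕ β = α ++ map (λ x → x + length α) β

swapVal : ℕ → ℕ → ℕ → ℕ
swapVal a b x = if ⌊ x ≟ a ⌋ then b else (if ⌊ x ≟ b ⌋ then a else x)

-- Interleave α ⊙ β: in α ⊕ β exchange the largest value from α (= |α|)
-- with the smallest value from β (= |α| + 1).
_⊙_ : Perm → Perm → Perm
α ⊙ β = map (swapVal (length α) (suc (length α))) (α ⊕ β)

infixl 6 _⊕_ _⊙_

p21 : Perm
p21 = 2 ∷ 1 ∷ []

p1 : Perm
p1 = 1 ∷ []

⊕pow : ℕ → Perm
⊕pow zero = []
⊕pow (suc zero) = p21
⊕pow (suc (suc r)) = ⊕pow (suc r) ⊕ p21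

-- ⊙^n(21) for n ≥ 1 (the value at 0 is a dummy, never used).
⊙pow : ℕ → Perm
⊙pow zero = []
⊙pow (suc zero) = p21
⊙pow (suc (suc n)) = ⊙pow (suc n) ⊙ p21

-- Increasing oscillations, indexed by n:
-- W-even n = W_{2n}, W-odd n = W_{2n-1}, M-even n = M_{2n}, M-odd n = M_{2n-1}.
W-even : ℕ → Perm
W-even n = ⊙pow n

W-odd : ℕ → Perm
W-odd zero = []
W-odd (suc k) = ⊙pow k ⊙ p1

M-even : ℕ → Perm
M-even zero = []
M-even (suc k) = (p1 ⊙ ⊙pow k) ⊙ p1

M-odd : ℕ → Perm
M-odd zero = []
M-odd (suc k) = p1 ⊙ ⊙pow k

{-# OPTIONS --safe #-}
-- Each increasing oscillation is order-isomorphic to an initial segment of the infinite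
-- oscillation osc = 3,0,5,2,7,4,… (up to one omitted position), so an occurrence of ⊕^r(21)
-- in it gives inversions (p_i, q_i) of osc with q_i < p_{i+1} and osc p_i < osc q_{i+1}.
-- Every inversion of osc has the form (2k, 2j+1), and the two cross conditions force k + j to
-- grow by at least 3 from one block to the next; the length of the segment bounds the last
-- block, which gives the inequalities.
module Submission where

open import Defs
open import Data.Nat
open import Data.Nat.Properties
open import Data.Nat.Tactic.RingSolver using (solve-∀)
open import Data.List using (List; []; _∷_; _++_; map; length; lookup)
open import Data.List.Properties using (length-++; length-map; map-id)
open import Data.List.Relation.Binary.Sublist.Propositional using (_⊆_)
open import Data.List.Relation.Binary.Sublist.Heterogeneous using ([]; _∷ʳ_; _∷_)
open import Data.Fin using (Fin; toℕ; fromℕ<; cast)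
open import Data.Fin.Properties using (toℕ-fromℕ<; toℕ-cast)
open import Data.Product using (_×_; _,_; ∃; proj₁)
open import Data.Sum using (_⊎_; inj₁; inj₂)
open import Function using (id; _∘_)
open import Function.Bundles using (Equivalence)
open import Relation.Binary.PropositionalEquality
open import Relation.Nullary using (yes; no; contradiction)
open import Relation.Nullary.Decidable using (dec-no)

at : List ℕ → ℕ → ℕ
at []       _       = 0
at (a ∷ _)  zero    = a
at (_ ∷ xs) (suc x) = at xs x

lookup≡at : (xs : List ℕ) (i : Fin (length xs)) → lookup xs i ≡ at xs (toℕ i)
lookup≡at (_ ∷ _)  Fin.zero    = refl
lookup≡at (_ ∷ xs) (Fin.suc i) = lookup≡at xs i

at-++ˡ : ∀ xs {ys x} → x < length xs → at (xs ++ ys) x ≡ at xs x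
at-++ˡ (_ ∷ _)  {x = zero}  _         = refl
at-++ˡ (_ ∷ xs) {x = suc x} (s≤s x<) = at-++ˡ xs x<

at-++ʳ : ∀ xs {ys} y → at (xs ++ ys) (length xs + y) ≡ at ys y
at-++ʳ []       y = refl
at-++ʳ (_ ∷ xs) y = at-++ʳ xs y

at-map : ∀ f xs {x} → x < length xs → at (map f xs) x ≡ f (at xs x)
at-map f (_ ∷ _)  {zero}  _        = refl
at-map f (_ ∷ xs) {suc x} (s≤s x<) = at-map f xs x<

<-+-split : ∀ m {n x} → x < m + n → x < m ⊎ ∃ λ y → y < n × x ≡ m + y
<-+-split zero    {x = x}     x<       = inj₂ (x , x< , refl)
<-+-split (suc m) {x = zero}  _        = inj₁ z<s
<-+-split (suc m) {x = suc x} (s≤s x<) with <-+-split m x<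
... | inj₁ x<m             = inj₁ (s≤s x<m)
... | inj₂ (y , y<n , refl) = inj₂ (y , y<n , refl)

record Tabulated (π : List ℕ) (N : ℕ) (F : ℕ → ℕ) : Set where
  field
    length≡ : length π ≡ N
    at≡     : ∀ {x} → x < N → at π x ≡ F x

map-⊕-tabulated : ∀ {α β L L' f g F} (h : ℕ → ℕ) →
  Tabulated α L f → Tabulated β L' g →
  (∀ {x} → x < L → h (f x) ≡ F x) → (∀ {y} → y < L' → h (g y + L) ≡ F (L + y)) →
  Tabulated (map h (α ⊕ β)) (L + L') F
map-⊕-tabulated {α} {β} {f = f} {g} {F} h record { length≡ = refl ; at≡ = at-α }
                                  record { length≡ = refl ; at≡ = at-β } left right =
  record { length≡ = trans (length-map h (α ⊕ β)) length-⊕ ; at≡ = values }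
  where
  length-⊕ : length (α ⊕ β) ≡ length α + length β
  length-⊕ = trans (length-++ α) (cong (length α +_) (length-map _ β))

  values : ∀ {x} → x < length α + length β → at (map h (α ⊕ β)) x ≡ F x
  values {x} x< with <-+-split (length α) x<
  ... | inj₁ x<L = begin
    at (map h (α ⊕ β)) x  ≡⟨ at-map h (α ⊕ β) (subst (x <_) (sym length-⊕) x<) ⟩
    h (at (α ⊕ β) x)      ≡⟨ cong h (at-++ˡ α x<L) ⟩
    h (at α x)            ≡⟨ cong h (at-α x<L) ⟩
    h (f x)               ≡⟨ left x<L ⟩
    F x                   ∎
    where open ≡-Reasoning
  ... | inj₂ (y , y<L' , refl) = begin
    at (map h (α ⊕ β)) (length α + y)  ≡⟨ at-map h (α ⊕ β) (subst (_ <_) (sym length-⊕) x<) ⟩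
    h (at (α ⊕ β) (length α + y))      ≡⟨ cong h (at-++ʳ α y) ⟩
    h (at (map _ β) y)                 ≡⟨ cong h (at-map _ β y<L') ⟩
    h (at β y + length α)              ≡⟨ cong (λ v → h (v + length α)) (at-β y<L') ⟩
    h (g y + length α)                 ≡⟨ right y<L' ⟩
    F (length α + y)                   ∎
    where open ≡-Reasoning

⊕-tabulated : ∀ {α β L L' f g F} →
  Tabulated α L f → Tabulated β L' g →
  (∀ {x} → x < L → f x ≡ F x) → (∀ {y} → y < L' → g y + L ≡ F (L + y)) →
  Tabulated (α ⊕ β) (L + L') F
⊕-tabulated {α} {β} {F = F} tα tβ left right =
  subst (λ π → Tabulated π _ F) (map-id (α ⊕ β)) (map-⊕-tabulated id tα tβ left right)

⊙-tabulated : ∀ {α β L L' f g F} →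
  Tabulated α L f → Tabulated β L' g →
  (∀ {x} → x < L → swapVal L (suc L) (f x) ≡ F x) →
  (∀ {y} → y < L' → swapVal L (suc L) (g y + L) ≡ F (L + y)) →
  Tabulated (α ⊙ β) (L + L') F
⊙-tabulated tα@record { length≡ = refl } = map-⊕-tabulated _ tα

p1-tabulated : Tabulated p1 1 (λ _ → 1)
p1-tabulated = record { length≡ = refl ; at≡ = λ { {zero} _ → refl ; {suc _} (s≤s ()) } }

double : ℕ → ℕ
double zero    = zero
double (suc n) = suc (suc (double n))

double-+ : ∀ m n → double (m + n) ≡ double m + double n
double-+ zero    n = refl
double-+ (suc m) n = cong (suc ∘ suc) (double-+ m n)

double-sum : ∀ m n → double m + suc (double n) ≡ suc (double (m + n))
double-sum m n = trans (+-suc (double m) (double n)) (cong suc (sym (double-+ m n)))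

double-mono-≤ : ∀ {m n} → m ≤ n → double m ≤ double n
double-mono-≤ z≤n       = z≤n
double-mono-≤ (s≤s m≤n) = s≤s (s≤s (double-mono-≤ m≤n))

double≤odd⇒≤ : ∀ {m n} → double m ≤ suc (double n) → m ≤ n
double≤odd⇒≤ {zero}          _               = z≤n
double≤odd⇒≤ {suc m} {suc n} (s≤s (s≤s m≤n)) = s≤s (double≤odd⇒≤ m≤n)

double-cancel-≤ : ∀ {m n} → double m ≤ double n → m ≤ n
double-cancel-≤ m≤n = double≤odd⇒≤ (m≤n⇒m≤1+n m≤n)

-- An occurrence of ⊕^r(21) in the sequence f at positions P 0 < Q 0 < P 1 < Q 1 < ⋯ below N;
-- comparing neighbouring blocks suffices.
record Chain (f : ℕ → ℕ) (N r : ℕ) : Set where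
  field
    P Q      : ℕ → ℕ
    P<Q      : ∀ {i} → i < r → P i < Q i
    Q<N      : ∀ {i} → i < r → Q i < N
    descent  : ∀ {i} → i < r → f (Q i) < f (P i)
    Q<P-next : ∀ {i} → suc i < r → Q i < P (suc i)
    ascent   : ∀ {i} → suc i < r → f (P i) < f (Q (suc i))

  P<N : ∀ {i} → i < r → P i < N
  P<N i<r = <-trans (P<Q i<r) (Q<N i<r)

  P+1<N : ∀ {i} → i < r → suc (P i) < N
  P+1<N i<r = ≤-trans (s≤s (P<Q i<r)) (Q<N i<r)

Chain-map : ∀ {f g N M r} (e : ℕ → ℕ) →
  (∀ {x y} → x < y → y < N → e x < e y) → (∀ {x} → x < N → e x < M) →
  (∀ {x y} → x < N → y < N → f x < f y → g (e x) < g (e y)) →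
  Chain f N r → Chain g M r
Chain-map e mono bound reflects C = record
  { P        = e ∘ P
  ; Q        = e ∘ Q
  ; P<Q      = λ i<r → mono (P<Q i<r) (Q<N i<r)
  ; Q<N      = λ i<r → bound (Q<N i<r)
  ; descent  = λ i<r → reflects (Q<N i<r) (P<N i<r) (descent i<r)
  ; Q<P-next = λ i+1<r → mono (Q<P-next i+1<r) (P<N i+1<r)
  ; ascent   = λ i+1<r → reflects (P<N (<⇒≤ i+1<r)) (Q<N i+1<r) (ascent i+1<r)
  }
  where open Chain C

tabulated-chain : ∀ {σ N F r} → Tabulated σ N F → Chain F N r → Chain (at σ) (length σ) r
tabulated-chain record { length≡ = refl ; at≡ = values } =
  Chain-map id (λ x<y _ → x<y) id (λ x< y< → subst₂ _<_ (sym (values x<)) (sym (values y<)))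

⊆-index : ∀ {τ π : List ℕ} → τ ⊆ π → ℕ → ℕ
⊆-index []       _       = 0
⊆-index (_ ∷ʳ s) x       = suc (⊆-index s x)
⊆-index (_ ∷ s)  zero    = 0
⊆-index (_ ∷ s)  (suc x) = suc (⊆-index s x)

at-⊆-index : ∀ {τ π x} (s : τ ⊆ π) → x < length τ → at τ x ≡ at π (⊆-index s x)
at-⊆-index               (_ ∷ʳ s)   x<       = at-⊆-index s x<
at-⊆-index {x = zero}    (refl ∷ s) _        = refl
at-⊆-index {x = suc x}   (refl ∷ s) (s≤s x<) = at-⊆-index s x<

⊆-index-< : ∀ {τ π x} (s : τ ⊆ π) → x < length τ → ⊆-index s x < length π
⊆-index-<             (_ ∷ʳ s)   x<       = s≤s (⊆-index-< s x<)
⊆-index-< {x = zero}  (refl ∷ s) _        = z<s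
⊆-index-< {x = suc x} (refl ∷ s) (s≤s x<) = s≤s (⊆-index-< s x<)

⊆-index-mono : ∀ {τ π x y} (s : τ ⊆ π) → x < y → y < length τ → ⊆-index s x < ⊆-index s y
⊆-index-mono                   (_ ∷ʳ s)   x<y       y<       = s≤s (⊆-index-mono s x<y y<)
⊆-index-mono {x = zero}  {suc y} (refl ∷ s) _         _        = z<s
⊆-index-mono {x = suc x} {suc y} (refl ∷ s) (s≤s x<y) (s≤s y<) = s≤s (⊆-index-mono s x<y y<)

OrderIso-at : ∀ {σ τ x y} → OrderIso σ τ → x < length σ → y < length σ →
  at σ x < at σ y → at τ x < at τ y
OrderIso-at {σ} {τ} (eq , iso) x< y< lt =
  subst₂ _<_ (lookup-cast x<) (lookup-cast y<)
    (Equivalence.to (iso (fromℕ< x<) (fromℕ< y<))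
      (subst₂ _<_ (sym (lookup-fromℕ< x<)) (sym (lookup-fromℕ< y<)) lt))
  where
  lookup-fromℕ< : ∀ {z} (z< : z < length σ) → lookup σ (fromℕ< z<) ≡ at σ z
  lookup-fromℕ< z< = trans (lookup≡at σ _) (cong (at σ) (toℕ-fromℕ< z<))

  lookup-cast : ∀ {z} (z< : z < length σ) → lookup τ (cast eq (fromℕ< z<)) ≡ at τ z
  lookup-cast z< = trans (lookup≡at τ _) (cong (at τ) (trans (toℕ-cast eq _) (toℕ-fromℕ< z<)))

≼-chain : ∀ {σ π r} → σ ≼ π → Chain (at σ) (length σ) r → Chain (at π) (length π) r
≼-chain {σ} (τ , τ⊆π , iso) =
  Chain-map (⊆-index τ⊆π)
    (λ x<y y< → ⊆-index-mono τ⊆π x<y (in-τ y<))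
    (λ x< → ⊆-index-< τ⊆π (in-τ x<))
    (λ x< y< lt → subst₂ _<_ (at-⊆-index τ⊆π (in-τ x<)) (at-⊆-index τ⊆π (in-τ y<))
                    (OrderIso-at {σ} {τ} iso x< y< lt))
  where
  in-τ : ∀ {x} → x < length σ → x < length τ
  in-τ = subst (_ <_) (proj₁ iso)

layered : ℕ → ℕ
layered zero          = 2
layered (suc zero)    = 1
layered (suc (suc x)) = suc (suc (layered x))

layered-even : ∀ i → layered (double i) ≡ 2 + double i
layered-even zero    = refl
layered-even (suc i) = cong (suc ∘ suc) (layered-even i)

layered-odd : ∀ i → layered (suc (double i)) ≡ suc (double i)
layered-odd zero    = refl
layered-odd (suc i) = cong (suc ∘ suc) (layered-odd i)

layered-shift : ∀ k y → layered (double k + y) ≡ layered y + double k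
layered-shift zero    y = sym (+-identityʳ (layered y))
layered-shift (suc k) y = begin
  suc (suc (layered (double k + y)))  ≡⟨ cong (suc ∘ suc) (layered-shift k y) ⟩
  suc (suc (layered y + double k))    ≡⟨ cong suc (sym (+-suc (layered y) (double k))) ⟩
  suc (layered y + suc (double k))    ≡⟨ sym (+-suc (layered y) (suc (double k))) ⟩
  layered y + double (suc k)          ∎
  where open ≡-Reasoning

p21-tabulated : Tabulated p21 2 layered
p21-tabulated = record { length≡ = refl ; at≡ = values }
  where
  values : ∀ {x} → x < 2 → at p21 x ≡ layered x
  values {0}           _                = refl
  values {1}           _                = refl
  values {suc (suc _)} (s≤s (s≤s ()))

⊕pow-tabulated : ∀ r → Tabulated (⊕pow r) (double r) layered
⊕pow-tabulated zero          = record { length≡ = refl ; at≡ = λ () }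
⊕pow-tabulated (suc zero)    = p21-tabulated
⊕pow-tabulated (suc (suc r)) =
  subst (λ N → Tabulated (⊕pow (suc (suc r))) N layered) (+-comm (double (suc r)) 2)
    (⊕-tabulated (⊕pow-tabulated (suc r)) p21-tabulated
      (λ _ → refl) (λ {y} _ → sym (layered-shift (suc r) y)))

layered-chain : ∀ r → Chain layered (double r) r
layered-chain r = record
  { P        = double
  ; Q        = suc ∘ double
  ; P<Q      = λ _ → n<1+n _
  ; Q<N      = double-mono-≤
  ; descent  = λ {i} _ → subst₂ _<_ (sym (layered-odd i)) (sym (layered-even i)) (n<1+n _)
  ; Q<P-next = λ _ → n<1+n _
  ; ascent   = λ {i} _ → subst₂ _<_ (sym (layered-even i)) (sym (layered-odd (suc i))) (n<1+n _)
  }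

pattern-chain : ∀ {π N r} → length π ≡ N → ⊕pow r ≼ π → Chain (at π) N r
pattern-chain {π} {r = r} length≡N σ≼π =
  subst (λ N → Chain (at π) N r) length≡N
    (≼-chain {⊕pow r} σ≼π (tabulated-chain (⊕pow-tabulated r) (layered-chain r)))

-- The increasing oscillation 4,1,6,3,8,5,… with positions counted from 0 and values lowered by 1.
osc : ℕ → ℕ
osc zero          = 3
osc (suc zero)    = 0
osc (suc (suc x)) = suc (suc (osc x))

osc-even : ∀ k → osc (double k) ≡ 3 + double k
osc-even zero    = refl
osc-even (suc k) = cong (suc ∘ suc) (osc-even k)

osc-odd : ∀ k → osc (suc (double k)) ≡ double k
osc-odd zero    = refl
osc-odd (suc k) = cong (suc ∘ suc) (osc-odd k)

data EvenOdd : ℕ → ℕ → Set where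
  even-odd : ∀ k j → EvenOdd (double k) (suc (double j))

osc-inversion : ∀ {p q} → p < q → osc q < osc p → EvenOdd p q
osc-inversion {0} {1}                 _ _ = even-odd 0 0
osc-inversion {0} {2}                 _ (s≤s (s≤s (s≤s ())))
osc-inversion {0} {3}                 _ _ = even-odd 0 1
osc-inversion {0} {suc (suc (suc (suc q)))} _ (s≤s (s≤s (s≤s ())))
osc-inversion {1}                     _ ()
osc-inversion {suc (suc p)} {suc (suc q)} (s≤s (s≤s p<q)) (s≤s (s≤s lt))
  with osc-inversion p<q lt
... | even-odd k j = even-odd (suc k) (suc j)

EvenOdd-step : ∀ {p q p' q'} → EvenOdd p q → EvenOdd p' q' → q < p' → osc p < osc q' →
  6 + (p + q) ≤ p' + q'
EvenOdd-step (even-odd k j) (even-odd k' j') q<p' lt = begin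
  6 + (double k + suc (double j))  ≡⟨ cong (6 +_) (double-sum k j) ⟩
  suc (double (3 + (k + j)))       ≡⟨ cong (suc ∘ double ∘ suc) (sym (+-suc (suc k) j)) ⟩
  suc (double (suc (suc k) + suc j)) ≤⟨ s≤s (double-mono-≤ (+-mono-≤ k+2≤j' j+1≤k')) ⟩
  suc (double (j' + k'))           ≡⟨ cong (suc ∘ double) (+-comm j' k') ⟩
  suc (double (k' + j'))           ≡⟨ sym (double-sum k' j') ⟩
  double k' + suc (double j')      ∎
  where
  open ≤-Reasoning
  j+1≤k' : suc j ≤ k'
  j+1≤k' = double-cancel-≤ q<p'
  k+2≤j' : suc (suc k) ≤ j'
  k+2≤j' = double-cancel-≤ (subst₂ _<_ (osc-even k) (osc-odd j') lt)

EvenOdd-sum-≥ : ∀ {p q c} → EvenOdd p q → double c ≤ q → suc (double c) ≤ p + q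
EvenOdd-sum-≥ (even-odd k j) 2c≤q =
  ≤-trans (s≤s (double-mono-≤ (double≤odd⇒≤ 2c≤q))) (m≤n+m (suc (double j)) (double k))

EvenOdd-sum-≤ : ∀ {p q a b} → EvenOdd p q → p < double (suc a) → q < double (suc b) →
  p + q ≤ suc (double (a + b))
EvenOdd-sum-≤ {a = a} {b} (even-odd k j) p< q< =
  ≤-trans (≤-reflexive (double-sum k j))
    (s≤s (double-mono-≤ (+-mono-≤ k≤a j≤b)))
  where
  k≤a : k ≤ a
  k≤a = double≤odd⇒≤ (s≤s⁻¹ p<)
  j≤b : j ≤ b
  j≤b = double-cancel-≤ (s≤s⁻¹ (s≤s⁻¹ q<))

module _ {M r : ℕ} (C : Chain osc M r) where
  open Chain C

  block : ∀ {i} → i < r → EvenOdd (P i) (Q i)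
  block i<r = osc-inversion (P<Q i<r) (descent i<r)

  osc-chain-growth : ∀ {i} → i < r → double (3 * i) + (P 0 + Q 0) ≤ P i + Q i
  osc-chain-growth {zero}  _     = ≤-refl
  osc-chain-growth {suc i} i+1<r = begin
    double (3 * suc i) + (P 0 + Q 0)   ≡⟨ cong (λ n → double n + (P 0 + Q 0)) (*-suc 3 i) ⟩
    6 + (double (3 * i) + (P 0 + Q 0)) ≤⟨ +-monoʳ-≤ 6 (osc-chain-growth (<⇒≤ i+1<r)) ⟩
    6 + (P i + Q i)                    ≤⟨ EvenOdd-step (block (<⇒≤ i+1<r)) (block i+1<r)
                                            (Q<P-next i+1<r) (ascent i+1<r) ⟩
    P (suc i) + Q (suc i)              ∎
    where open ≤-Reasoning

osc-chain-bound : ∀ {r a b c} (C : Chain osc (double (suc b)) (suc r)) →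
  Chain.P C r < double (suc a) → double c ≤ Chain.Q C 0 → 3 * r + c ≤ a + b
osc-chain-bound {r} {a} {b} {c} C Pr< 2c≤Q0 = double-cancel-≤ (s≤s⁻¹ (begin
  suc (double (3 * r + c))       ≡⟨ sym (double-sum (3 * r) c) ⟩
  double (3 * r) + suc (double c) ≤⟨ +-monoʳ-≤ _ (EvenOdd-sum-≥ (block C z<s) 2c≤Q0) ⟩
  double (3 * r) + (P 0 + Q 0)   ≤⟨ osc-chain-growth C ≤-refl ⟩
  P r + Q r                      ≤⟨ EvenOdd-sum-≤ (block C ≤-refl) Pr< (Q<N ≤-refl) ⟩
  suc (double (a + b))           ∎))
  where
  open Chain C
  open ≤-Reasoning

mono-reflects-< : ∀ {h : ℕ → ℕ} → (∀ {a b} → a ≤ b → h a ≤ h b) →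
  ∀ {a b} → h a < h b → a < b
mono-reflects-< h-mono {a} {b} lt with a <? b
... | yes a<b = a<b
... | no  a≮b = contradiction (h-mono (≮⇒≥ a≮b)) (<⇒≱ lt)

into-osc : ∀ {π N M r} (h e : ℕ → ℕ) → Tabulated π N (h ∘ osc ∘ e) →
  (∀ {a b} → a ≤ b → h a ≤ h b) → (∀ {x y} → x < y → e x < e y) →
  (∀ {x} → x < N → e x < M) → Chain (at π) N r → Chain osc M r
into-osc h e tab h-mono e-mono e-bound =
  Chain-map e (λ x<y _ → e-mono x<y) e-bound
    (λ x< y< lt → mono-reflects-< h-mono (subst₂ _<_ (at≡ x<) (at≡ y<) lt))
  where open Tabulated tab

swap-left : ∀ L → swapVal L (suc L) L ≡ suc L
swap-left L rewrite ≟-diag (refl {x = L}) = refl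

swap-right : ∀ L → swapVal L (suc L) (suc L) ≡ L
swap-right L rewrite dec-no (suc L ≟ L) 1+n≢n | ≟-diag (refl {x = suc L}) = refl

swap-other : ∀ {L x} → x ≢ L → x ≢ suc L → swapVal L (suc L) x ≡ x
swap-other {L} {x} x≢L x≢L+1 rewrite dec-no (x ≟ L) x≢L | dec-no (x ≟ suc L) x≢L+1 = refl

swap-below : ∀ {L x} → x < L → swapVal L (suc L) x ≡ x
swap-below x<L = swap-other (<⇒≢ x<L) (<⇒≢ (m<n⇒m<1+n x<L))

swap-above : ∀ {L x} → suc L < x → swapVal L (suc L) x ≡ x
swap-above L+1<x = swap-other (>⇒≢ (<-trans (n<1+n _) L+1<x)) (>⇒≢ L+1<x)

clamp : ℕ → ℕ → ℕ
clamp c z = 1 ⊔ (z ⊓ c)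

clamp-mono : ∀ c {a b} → a ≤ b → clamp c a ≤ clamp c b
clamp-mono c a≤b = ⊔-monoʳ-≤ 1 (⊓-monoˡ-≤ c a≤b)

clamp-below : ∀ {c z} → z ≤ c → clamp c z ≡ 1 ⊔ z
clamp-below z≤c = cong (1 ⊔_) (m≤n⇒m⊓n≡m z≤c)

clamp-above : ∀ {c z} → 1 ≤ c → c ≤ z → clamp c z ≡ c
clamp-above 1≤c c≤z = trans (cong (1 ⊔_) (m≥n⇒m⊓n≡n c≤z)) (m≤n⇒m⊔n≡n 1≤c)

osc≢1 : ∀ x → osc x ≢ 1
osc≢1 zero          ()
osc≢1 (suc zero)    ()
osc≢1 (suc (suc x)) ()

osc-prefix : ∀ m {x} → x < double (suc m) →
  osc x < double (suc m) ⊎ osc x ≡ suc (double (suc m))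
osc-prefix zero    {0}           _ = inj₂ refl
osc-prefix zero    {1}           _ = inj₁ z<s
osc-prefix zero    {suc (suc _)} (s≤s (s≤s ()))
osc-prefix (suc m) {0}           _ = inj₁ (s≤s (s≤s (s≤s (s≤s z≤n))))
osc-prefix (suc m) {1}           _ = inj₁ z<s
osc-prefix (suc m) {suc (suc x)} (s≤s (s≤s x<)) with osc-prefix m x<
... | inj₁ lt = inj₁ (s≤s (s≤s lt))
... | inj₂ eq = inj₂ (cong (suc ∘ suc) eq)

osc-prefix-≤ : ∀ m {x} → x < double (suc m) → osc x ≤ suc (double (suc m))
osc-prefix-≤ m x< with osc-prefix m x<
... | inj₁ lt = m<n⇒m≤1+n lt
... | inj₂ eq = ≤-reflexive eq

swap-clamp-osc : ∀ m {x} → x < double (suc m) →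
  swapVal (double (suc m)) (suc (double (suc m))) (clamp (double (suc m)) (osc x)) ≡ 1 ⊔ osc x
swap-clamp-osc m {x} x< with osc-prefix m x<
... | inj₁ lt =
  trans (cong (swapVal (double (suc m)) _) (clamp-below (<⇒≤ lt)))
    (swap-below (⊔-lub (s≤s (s≤s z≤n)) lt))
... | inj₂ eq rewrite eq =
  trans (cong (swapVal (double (suc m)) _) (clamp-above z<s (n≤1+n (double (suc m)))))
    (swap-left (double (suc m)))

W-even-tabulated : ∀ m → Tabulated (W-even (suc m)) (double (suc m)) (clamp (double (suc m)) ∘ osc)
W-even-tabulated zero    = record { length≡ = refl ; at≡ = values }
  where
  values : ∀ {x} → x < 2 → at (W-even 1) x ≡ clamp 2 (osc x)
  values {0}           _ = refl
  values {1}           _ = refl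
  values {suc (suc _)} (s≤s (s≤s ()))
W-even-tabulated (suc m) =
  subst (λ N → Tabulated (W-even (suc (suc m))) N (clamp (2 + T) ∘ osc)) (+-comm T 2)
    (⊙-tabulated (W-even-tabulated m) p21-tabulated left right)
  where
  T = double (suc m)

  left : ∀ {x} → x < T → swapVal T (suc T) (clamp T (osc x)) ≡ clamp (2 + T) (osc x)
  left x< = trans (swap-clamp-osc m x<) (sym (clamp-below (m≤n⇒m≤1+n (osc-prefix-≤ m x<))))

  right : ∀ {y} → y < 2 → swapVal T (suc T) (layered y + T) ≡ clamp (2 + T) (osc (T + y))
  right {0} _ = begin
    swapVal T (suc T) (2 + T)    ≡⟨ swap-above {T} ≤-refl ⟩
    2 + T                        ≡⟨ sym (clamp-above z<s (n≤1+n _)) ⟩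
    clamp (2 + T) (3 + T)        ≡⟨ cong (clamp (2 + T)) (sym (osc-even (suc m))) ⟩
    clamp (2 + T) (osc T)        ≡⟨ cong (clamp (2 + T) ∘ osc) (sym (+-identityʳ T)) ⟩
    clamp (2 + T) (osc (T + 0))  ∎
    where open ≡-Reasoning
  right {1} _ = begin
    swapVal T (suc T) (1 + T)    ≡⟨ swap-right T ⟩
    T                            ≡⟨ sym (clamp-below (m≤n⇒m≤1+n (n≤1+n T))) ⟩
    clamp (2 + T) T              ≡⟨ cong (clamp (2 + T)) (sym (osc-odd (suc m))) ⟩
    clamp (2 + T) (osc (1 + T))  ≡⟨ cong (clamp (2 + T) ∘ osc) (+-comm 1 T) ⟩
    clamp (2 + T) (osc (T + 1))  ∎
    where open ≡-Reasoning
  right {suc (suc _)} (s≤s (s≤s ()))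

-- W_{2n-1}, M_{2n-1} and M_{2n} sit in osc at the positions listed by skipAfter, skip1 and
-- skip1 ∘ skipAfter, respectively.
skipAfter : ℕ → ℕ → ℕ
skipAfter c x = x + (x ∸ c)

skipAfter-id : ∀ {c x} → x ≤ c → skipAfter c x ≡ x
skipAfter-id {x = x} x≤c = trans (cong (x +_) (m≤n⇒m∸n≡0 x≤c)) (+-identityʳ x)

skipAfter-suc : ∀ c → skipAfter c (suc c) ≡ suc (suc c)
skipAfter-suc c = trans (cong (suc c +_) (m+n∸n≡m 1 c)) (+-comm (suc c) 1)

skipAfter-≤ : ∀ {c x} → x ≤ suc c → skipAfter c x ≤ suc x
skipAfter-≤ {c} {x} x≤c+1 = begin
  x + (x ∸ c)      ≤⟨ +-monoʳ-≤ x (∸-monoˡ-≤ c x≤c+1) ⟩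
  x + (suc c ∸ c)  ≡⟨ cong (x +_) (m+n∸n≡m 1 c) ⟩
  x + 1            ≡⟨ +-comm x 1 ⟩
  suc x            ∎
  where open ≤-Reasoning

skipAfter-mono : ∀ c {x y} → x < y → skipAfter c x < skipAfter c y
skipAfter-mono c x<y = +-mono-<-≤ x<y (∸-monoˡ-≤ c (<⇒≤ x<y))

skip1 : ℕ → ℕ
skip1 zero    = zero
skip1 (suc x) = suc (suc x)

skip1-≤ : ∀ x → skip1 x ≤ suc x
skip1-≤ zero    = z≤n
skip1-≤ (suc x) = ≤-refl

skip1-mono : ∀ {x y} → x < y → skip1 x < skip1 y
skip1-mono {zero}  {suc y} _         = z<s
skip1-mono {suc x} {suc y} (s≤s x<y) = s≤s (s≤s x<y)

skip1-≥2 : ∀ {x} → 1 ≤ x → 2 ≤ skip1 x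
skip1-≥2 {suc x} _ = s≤s (s≤s z≤n)

W-odd-tabulated : ∀ m → Tabulated (W-odd (suc (suc m))) (suc (double (suc m)))
                                   ((1 ⊔_) ∘ osc ∘ skipAfter (suc (double m)))
W-odd-tabulated m =
  subst (λ N → Tabulated (W-odd (suc (suc m))) N ((1 ⊔_) ∘ osc ∘ skipAfter c)) (+-comm T 1)
    (⊙-tabulated (W-even-tabulated m) p1-tabulated left right)
  where
  c = suc (double m)
  T = suc c

  left : ∀ {x} → x < T → swapVal T (suc T) (clamp T (osc x)) ≡ 1 ⊔ osc (skipAfter c x)
  left x< = trans (swap-clamp-osc m x<) (cong ((1 ⊔_) ∘ osc) (sym (skipAfter-id (s≤s⁻¹ x<))))

  right : ∀ {y} → y < 1 → swapVal T (suc T) (1 + T) ≡ 1 ⊔ osc (skipAfter c (T + y))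
  right {0} _ = begin
    swapVal T (suc T) (1 + T)          ≡⟨ swap-right T ⟩
    T                                  ≡⟨ sym (osc-odd (suc m)) ⟩
    1 ⊔ osc (suc T)                    ≡⟨ cong ((1 ⊔_) ∘ osc) (sym (skipAfter-suc c)) ⟩
    1 ⊔ osc (skipAfter c T)            ≡⟨ cong ((1 ⊔_) ∘ osc ∘ skipAfter c) (sym (+-identityʳ T)) ⟩
    1 ⊔ osc (skipAfter c (T + 0))      ∎
    where open ≡-Reasoning
  right {suc _} (s≤s ())

swap12-clamp : ∀ c w → w ≢ 1 → swapVal 1 2 (clamp (suc (suc c)) w + 1) ≡ suc w ⊓ suc (suc (suc c))
swap12-clamp c zero          _   = refl
swap12-clamp c (suc zero)    w≢1 = contradiction refl w≢1
swap12-clamp c (suc (suc w)) _   =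
  trans (swap-above {1} (s≤s (s≤s (m≤n+m 1 (w ⊓ c))))) (cong (suc ∘ suc) (+-comm (w ⊓ c) 1))

M-odd-tabulated : ∀ m → Tabulated (M-odd (suc (suc m))) (suc (double (suc m)))
                                   ((_⊓ suc (double (suc m))) ∘ pred ∘ osc ∘ skip1)
M-odd-tabulated m = ⊙-tabulated p1-tabulated (W-even-tabulated m) left right
  where
  left : ∀ {x} → x < 1 → swapVal 1 2 1 ≡ pred (osc (skip1 x)) ⊓ suc (double (suc m))
  left {0}     _        = refl
  left {suc _} (s≤s ())

  right : ∀ {y} → y < double (suc m) →
    swapVal 1 2 (clamp (double (suc m)) (osc y) + 1) ≡ suc (osc y) ⊓ suc (double (suc m))
  right {y} _ = swap12-clamp (double m) (osc y) (osc≢1 y)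

swap-pred-osc : ∀ m {z} → z < double (suc (suc m)) →
  swapVal (suc (double (suc m))) (suc (suc (double (suc m)))) (pred (osc z) ⊓ suc (double (suc m)))
    ≡ pred (osc z)
swap-pred-osc m {z} z< with osc-prefix (suc m) z<
... | inj₁ lt =
  trans (cong (swapVal (suc (double (suc m))) _) (m≤n⇒m⊓n≡m (m≤n⇒m≤1+n pred-osc≤)))
    (swap-below (s≤s pred-osc≤))
  where
  pred-osc≤ : pred (osc z) ≤ double (suc m)
  pred-osc≤ = pred-mono-≤ (s≤s⁻¹ lt)
... | inj₂ eq rewrite eq =
  trans (cong (swapVal (suc (double (suc m))) _) (m≥n⇒m⊓n≡n (n≤1+n (suc (double (suc m))))))
    (swap-left (suc (double (suc m))))

M-even-tabulated : ∀ m → Tabulated (M-even (suc (suc m))) (suc (suc (double (suc m))))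
                                    (pred ∘ osc ∘ skip1 ∘ skipAfter (double (suc m)))
M-even-tabulated m =
  subst (λ N → Tabulated (M-even (suc (suc m))) N (pred ∘ osc ∘ skip1 ∘ skipAfter T)) (+-comm U 1)
    (⊙-tabulated (M-odd-tabulated m) p1-tabulated left right)
  where
  T = double (suc m)
  U = suc T

  left : ∀ {x} → x < U →
    swapVal U (suc U) (pred (osc (skip1 x)) ⊓ U) ≡ pred (osc (skip1 (skipAfter T x)))
  left {x} x< =
    trans (swap-pred-osc m (s≤s (≤-trans (skip1-≤ x) x<)))
      (cong (pred ∘ osc ∘ skip1) (sym (skipAfter-id (s≤s⁻¹ x<))))

  right : ∀ {y} → y < 1 → swapVal U (suc U) (1 + U) ≡ pred (osc (skip1 (skipAfter T (U + y))))
  right {0} _ = begin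
    swapVal U (suc U) (1 + U)                 ≡⟨ swap-right U ⟩
    U                                         ≡⟨ cong suc (sym (osc-odd (suc m))) ⟩
    pred (osc (skip1 (suc U)))                ≡⟨ cong (pred ∘ osc ∘ skip1) (sym (skipAfter-suc T)) ⟩
    pred (osc (skip1 (skipAfter T U)))
      ≡⟨ cong (pred ∘ osc ∘ skip1 ∘ skipAfter T) (sym (+-identityʳ U)) ⟩
    pred (osc (skip1 (skipAfter T (U + 0))))  ∎
    where open ≡-Reasoning
  right {suc _} (s≤s ())

W-even-bound : ∀ {r m} → ⊕pow (suc r) ≼ W-even (suc m) → 3 * suc r ∸ 1 ≤ 2 * suc m
W-even-bound {r} {m} σ≼π = begin
  3 * suc r ∸ 1    ≡⟨ cong (_∸ 1) (*-suc 3 r) ⟩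
  2 + 3 * r        ≤⟨ +-monoʳ-≤ 2 (m+n≤o⇒m≤o (3 * r) (osc-chain-bound C Pr< z≤n)) ⟩
  2 + (m + m)      ≡⟨ arith m ⟩
  2 * suc m        ∎
  where
  arith : ∀ m → 2 + (m + m) ≡ 2 * suc m
  arith = solve-∀
  tab = W-even-tabulated m
  C : Chain osc (double (suc m)) (suc r)
  C = into-osc (clamp (double (suc m))) id tab (clamp-mono _) id id
        (pattern-chain (Tabulated.length≡ tab) σ≼π)
  Pr< : Chain.P C r < double (suc m)
  Pr< = Chain.P<N C ≤-refl
  open ≤-Reasoning

W-odd-bound : ∀ {r m} → ⊕pow (suc r) ≼ W-odd (suc (suc m)) → 3 * suc r ≤ 2 * suc (suc m)
W-odd-bound {r} {m} σ≼π = begin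
  3 * suc r          ≡⟨ *-suc 3 r ⟩
  3 + 3 * r          ≤⟨ +-monoʳ-≤ 3 (m+n≤o⇒m≤o (3 * r) (osc-chain-bound C Pr< z≤n)) ⟩
  3 + (m + suc m)    ≡⟨ arith m ⟩
  2 * suc (suc m)    ∎
  where
  arith : ∀ m → 3 + (m + suc m) ≡ 2 * suc (suc m)
  arith = solve-∀
  c = suc (double m)
  tab = W-odd-tabulated m
  D = pattern-chain (Tabulated.length≡ tab) σ≼π
  e-bound : ∀ {x} → x < suc (suc c) → skipAfter c x < suc (suc (suc c))
  e-bound x< = s≤s (≤-trans (skipAfter-≤ (s≤s⁻¹ x<)) x<)
  C : Chain osc (double (suc (suc m))) (suc r)
  C = into-osc (1 ⊔_) (skipAfter c) tab (⊔-monoʳ-≤ 1) (skipAfter-mono c) e-bound D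
  Pr≤c : Chain.P D r ≤ c
  Pr≤c = s≤s⁻¹ (s≤s⁻¹ (Chain.P+1<N D ≤-refl))
  Pr< : Chain.P C r < double (suc m)
  Pr< = subst (_< suc c) (sym (skipAfter-id Pr≤c)) (s≤s Pr≤c)
  open ≤-Reasoning

M-odd-bound : ∀ {r m} → ⊕pow (suc r) ≼ M-odd (suc (suc m)) → 3 * suc r ≤ 2 * suc (suc m)
M-odd-bound {r} {m} σ≼π = begin
  3 * suc r            ≡⟨ *-suc 3 r ⟩
  2 + (1 + 3 * r)      ≡⟨ cong (2 +_) (+-comm 1 (3 * r)) ⟩
  2 + (3 * r + 1)      ≤⟨ +-monoʳ-≤ 2 (osc-chain-bound C (Chain.P<N C ≤-refl) Q0≥2) ⟩
  2 + (suc m + suc m)  ≡⟨ arith m ⟩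
  2 * suc (suc m)      ∎
  where
  arith : ∀ m → 2 + (suc m + suc m) ≡ 2 * suc (suc m)
  arith = solve-∀
  T = double (suc m)
  tab = M-odd-tabulated m
  D = pattern-chain (Tabulated.length≡ tab) σ≼π
  e-bound : ∀ {x} → x < suc T → skip1 x < suc (suc T)
  e-bound {x} x< = s≤s (≤-trans (skip1-≤ x) x<)
  C : Chain osc (double (suc (suc m))) (suc r)
  C = into-osc ((_⊓ suc T) ∘ pred) skip1 tab (⊓-monoˡ-≤ (suc T) ∘ pred-mono-≤) skip1-mono e-bound D
  Q0≥2 : 2 ≤ Chain.Q C 0
  Q0≥2 = skip1-≥2 (≤-trans (s≤s z≤n) (Chain.P<Q D z<s))
  open ≤-Reasoning

M-even-bound : ∀ {r m} → ⊕pow (suc r) ≼ M-even (suc (suc m)) → 3 * suc r ∸ 1 ≤ 2 * suc (suc m)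
M-even-bound {r} {m} σ≼π = begin
  3 * suc r ∸ 1              ≡⟨ cong (_∸ 1) (*-suc 3 r) ⟩
  1 + (1 + 3 * r)            ≡⟨ cong (1 +_) (+-comm 1 (3 * r)) ⟩
  1 + (3 * r + 1)            ≤⟨ +-monoʳ-≤ 1 (osc-chain-bound C Pr< Q0≥2) ⟩
  1 + (suc m + suc (suc m))  ≡⟨ arith m ⟩
  2 * suc (suc m)            ∎
  where
  arith : ∀ m → 1 + (suc m + suc (suc m)) ≡ 2 * suc (suc m)
  arith = solve-∀
  T = double (suc m)
  tab = M-even-tabulated m
  D = pattern-chain (Tabulated.length≡ tab) σ≼π
  e-bound : ∀ {x} → x < suc (suc T) → skip1 (skipAfter T x) < suc (suc (suc (suc T)))
  e-bound {x} x< =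
    s≤s (≤-trans (skip1-≤ (skipAfter T x)) (s≤s (≤-trans (skipAfter-≤ (s≤s⁻¹ x<)) x<)))
  C : Chain osc (double (suc (suc (suc m)))) (suc r)
  C = into-osc pred (skip1 ∘ skipAfter T) tab pred-mono-≤ (skip1-mono ∘ skipAfter-mono T) e-bound D
  Pr≤T : Chain.P D r ≤ T
  Pr≤T = s≤s⁻¹ (s≤s⁻¹ (Chain.P+1<N D ≤-refl))
  Pr< : Chain.P C r < double (suc (suc m))
  Pr< = subst (λ p → skip1 p < suc (suc T)) (sym (skipAfter-id Pr≤T))
          (s≤s (≤-trans (skip1-≤ (Chain.P D r)) (s≤s Pr≤T)))
  Q0≥2 : 2 ≤ Chain.Q C 0
  Q0≥2 = skip1-≥2 (≤-trans (≤-trans (s≤s z≤n) (Chain.P<Q D z<s)) (m≤m+n _ _))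
  open ≤-Reasoning

lemma15 : (π : Perm) (r n : ℕ) → 1 ≤ r → ⊕pow r ≼ π →
    ((2 ≤ n × (π ≡ W-even n ⊎ π ≡ M-even n)) → 3 * r ∸ 1 ≤ 2 * n)
    × ((3 ≤ n × (π ≡ W-odd n ⊎ π ≡ M-odd n)) → 3 * r ≤ 2 * n)
lemma15 π (suc r) n _ σ≼π = even , odd
  where
  even : 2 ≤ n × (π ≡ W-even n ⊎ π ≡ M-even n) → 3 * suc r ∸ 1 ≤ 2 * n
  even (s≤s (s≤s _) , inj₁ refl) = W-even-bound σ≼π
  even (s≤s (s≤s _) , inj₂ refl) = M-even-bound σ≼π

  odd : 3 ≤ n × (π ≡ W-odd n ⊎ π ≡ M-odd n) → 3 * suc r ≤ 2 * n
  odd (s≤s (s≤s (s≤s _)) , inj₁ refl) = W-odd-bound σ≼π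
  odd (s≤s (s≤s (s≤s _)) , inj₂ refl) = M-odd-bound σ≼π
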